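{- Let $\mathcal{M}$ be a finite unitary magma. Then the Koszul dual $\mathrm{NC}\mathcal{M}^!$ of $\mathrm{NC}\mathcal{M}$ admits the presentation $(\mathcal{T}_\mathcal{M},\mathfrak{R}^!_{\mathrm{NC}\mathcal{M}})$, where $\mathfrak{R}^!_{\mathrm{NC}\mathcal{M}}$ is the subspace of $\mathrm{Free}(\mathbb{K}\langle\mathcal{T}_\mathcal{M}\rangle)(3)$ spanned by the elements (1) $\sum_{p_1,q_0\in\mathcal{M},\,p_1\star q_0=\delta}\mathrm{T}(p_0,p_1,p_2)\circ_1\mathrm{T}(q_0,q_1,q_2)$ for $p_0,p_2,q_1,q_2\in\mathcal{M}$ and $\delta\in\mathcal{M}\setminus\{1_\mathcal{M}\}$; (2) $\sum_{p_1,q_0\in\mathcal{M},\,p_1\star q_0=1_\mathcal{M}}\big(\mathrm{T}(p_0,p_1,p_2)\circ_1\mathrm{T}(q_0,q_1,q_2)-\mathrm{T}(p_0,q_1,p_1)\circ_2\mathrm{T}(q_0,q_2,p_2)\big)$ for $p_0,p_2,q_1,q_2\in\mathcal{M}$; (3) $\sum_{p_2,q_0\in\mathcal{M},\,p_2\star q_0=\delta}\mathrm{T}(p_0,p_1,p_2)\circ_2\mathrm{T}(q_0,q_1,q_2)$ for $p_0,p_1,q_1,q_2\in\mathcal{M}$ and $\delta\in\mathcal{M}\setminus\{1_\mathcal{M}\}$.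
   Context: $\mathbb{K}$ is a field of characteristic zero. A unitary magma $\mathcal{M}$ is a set with binary operation $\star$ and two-sided unit $1_\mathcal{M}$. For $n\ge1$, an $\mathcal{M}$-clique of arity $n$ labels each arc $(x,y)$, $1\le x<y\le n+1$, of a polygon with vertices $1,\dots,n+1$ by an element of $\mathcal{M}$; base $(1,n+1)$ (label $\mathfrak{p}_0$), edges $(i,i+1)$ (labels $\mathfrak{p}_i$), other arcs diagonals. Solid: label $\neq1_\mathcal{M}$; noncrossing: no two crossing solid diagonals. $\mathfrak{p}\circ_i\mathfrak{q}$ glues the base of $\mathfrak{q}$ (arity $m$) onto the $i$th edge of $\mathfrak{p}$, arcs keep labels with the obvious vertex shifts, the common arc $(i,i+m)$ gets $\mathfrak{p}_i\star\mathfrak{q}_0$, other arcs $1_\mathcal{M}$; $\mathrm{NC}\mathcal{M}$ is the operad spanned by noncrossing cliques. $\mathcal{T}_\mathcal{M}$ is the set of $\mathcal{M}$-cliques of arity 2 (triangles); $\mathrm{T}(a,b,c)$ is the triangle with base $a$, first edge $b$, second edge $c$; $\mathrm{Free}(\mathbb{K}\langle\mathcal{T}_\mathcal{M}\rangle)$ is the free operad on these binary generators, and $x\circ_i y$ the degree-2 tree grafting $y$ on the $i$th leaf of $x$. It is known (Theorem 3.15 of the paper) that $\mathrm{NC}\mathcal{M}$ has the binary quadratic presentation $(\mathcal{T}_\mathcal{M},\mathfrak{R})$ with $\mathfrak{R}$ spanned by the differences $\mathrm{T}(p_0,p_1,p_2)\circ_1\mathrm{T}(q_0,q_1,q_2)-\mathrm{T}(p_0,r_1,p_2)\circ_1\mathrm{T}(r_0,q_1,q_2)$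 ($p_1\star q_0=r_1\star r_0\neq1_\mathcal{M}$), $\mathrm{T}(p_0,p_1,p_2)\circ_1\mathrm{T}(q_0,q_1,q_2)-\mathrm{T}(p_0,q_1,r_2)\circ_2\mathrm{T}(r_0,q_2,p_2)$ ($p_1\star q_0=r_2\star r_0=1_\mathcal{M}$), $\mathrm{T}(p_0,p_1,p_2)\circ_2\mathrm{T}(q_0,q_1,q_2)-\mathrm{T}(p_0,p_1,r_2)\circ_2\mathrm{T}(r_0,q_1,q_2)$ ($p_2\star q_0=r_2\star r_0\neq1_\mathcal{M}$). The Koszul dual $\mathrm{NC}\mathcal{M}^!$ is the operad with presentation $(\mathcal{T}_\mathcal{M},\mathfrak{R}^\perp)$, where $\mathfrak{R}^\perp$ is the annihilator of $\mathfrak{R}$ for the bilinear form on $\mathrm{Free}(\mathbb{K}\langle\mathcal{T}_\mathcal{M}\rangle)(3)$ with $\langle x\circ_i y,x'\circ_{i'}y'\rangle=1$ if $x=x'$, $y=y'$, $i=i'=1$, $=-1$ if $x=x'$, $y=y'$, $i=i'=2$, and $0$ otherwise. -}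

module Defs where

open import Level using (Level; _⊔_; suc)
open import Data.Nat using (ℕ; zero) renaming (suc to sucℕ)
open import Data.Fin using (Fin) renaming (zero to fz; suc to fs)
open import Data.Fin.Properties using (_≟_)
open import Data.Product using (Σ; ∃; _×_; _,_; proj₁; proj₂)
open import Data.List using (List; []; _∷_)
import Data.List
open import Relation.Nullary using (¬_; yes; no)
open import Relation.Binary.PropositionalEquality using (_≡_)
open import Algebra.Bundles using (CommutativeRing)

record Field c ℓ : Set (suc (c ⊔ ℓ)) where
  field
    commutativeRing : CommutativeRing c ℓ
  open CommutativeRing commutativeRing public
  field
    0≉1      : ¬ (0# ≈ 1#)
    inverse  : ∀ x → ¬ (x ≈ 0#) → Σ Carrier λ y → (x * y) ≈ 1#

  ι : ℕ → Carrier
  ι zero     = 0#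
  ι (sucℕ n) = 1# + ι n

record CharZeroField c ℓ : Set (suc (c ⊔ ℓ)) where
  field
    field′   : Field c ℓ
  open Field field′ public
  field
    charZero : ∀ n → ¬ (ι (sucℕ n) ≈ 0#)

record FiniteUnitaryMagma : Set where
  field
    size   : ℕ
    _⋆_    : Fin size → Fin size → Fin size
    𝟙      : Fin size
    unitˡ  : ∀ x → 𝟙 ⋆ x ≡ x
    unitʳ  : ∀ x → x ⋆ 𝟙 ≡ x

module Koszul {c ℓ} (K : CharZeroField c ℓ) (M : FiniteUnitaryMagma) where
  open CharZeroField K
  open FiniteUnitaryMagma M

  Elt : Set
  Elt = Fin size

  sumFin : ∀ {n} → (Fin n → Carrier) → Carrier
  sumFin {zero}   f = 0#
  sumFin {sucℕ n} f = f fz + sumFin (λ i → f (fs i))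

  -- triangles T(a,b,c): base a, first edge b, second edge c
  Tri : Set
  Tri = Elt × Elt × Elt

  T : Elt → Elt → Elt → Tri
  T a b c = a , b , c

  -- basis of Free(K⟨T_M⟩)(3): trees x ∘_i y, with i ∈ Fin 2
  -- (fz stands for ∘₁, fs fz stands for ∘₂)
  Basis : Set
  Basis = Tri × Tri × Fin 2

  Vec3 : Set c
  Vec3 = Basis → Carrier

  _≈V_ : Vec3 → Vec3 → Set ℓ
  u ≈V v = ∀ b → u b ≈ v b

  0V : Vec3
  0V _ = 0#

  _+V_ : Vec3 → Vec3 → Vec3
  (u +V v) b = u b + v b

  _-V_ : Vec3 → Vec3 → Vec3
  (u -V v) b = u b - v b

  _·V_ : Carrier → Vec3 → Vec3
  (k ·V v) b = k * v b

  sumV : ∀ {n} → (Fin n → Vec3) → Vec3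
  sumV f b = sumFin (λ i → f i b)

  eqTri : Tri → Tri → Carrier
  eqTri (a , b , c) (a′ , b′ , c′) with a ≟ a′ | b ≟ b′ | c ≟ c′
  ... | yes _ | yes _ | yes _ = 1#
  ... | _     | _     | _     = 0#

  eqFin2 : Fin 2 → Fin 2 → Carrier
  eqFin2 i j with i ≟ j
  ... | yes _ = 1#
  ... | no  _ = 0#

  _∘⟨_⟩_ : Tri → Fin 2 → Tri → Vec3
  (x ∘⟨ i ⟩ y) (x′ , y′ , i′) = eqTri x x′ * (eqTri y y′ * eqFin2 i i′)

  ∘₁ ∘₂ : Fin 2
  ∘₁ = fz
  ∘₂ = fs fz

  [_≡_] : Elt → Elt → Carrier
  [ a ≡ b ] with a ≟ b
  ... | yes _ = 1#
  ... | no  _ = 0#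

  sign : Fin 2 → Carrier
  sign fz      = 1#
  sign (fs _)  = - 1#

  ⟨_,_⟩ : Vec3 → Vec3 → Carrier
  ⟨ u , v ⟩ =
    sumFin λ a → sumFin λ b → sumFin λ c →
    sumFin λ a′ → sumFin λ b′ → sumFin λ c′ →
    sumFin λ i →
      sign i * (u ((a , b , c) , (a′ , b′ , c′) , i) * v ((a , b , c) , (a′ , b′ , c′) , i))

  lincomb : List (Carrier × Vec3) → Vec3
  lincomb []             = 0V
  lincomb ((k , w) ∷ ws) = (k ·V w) +V lincomb ws

  Span : (Vec3 → Set (c ⊔ ℓ)) → Vec3 → Set (c ⊔ ℓ)
  Span P v = Σ (List (Carrier × Σ Vec3 P)) λ ws →
               v ≈V lincomb (Data.List.map (λ { (k , (w , _)) → (k , w) }) ws)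

  Annihilator : (Vec3 → Set (c ⊔ ℓ)) → Vec3 → Set (c ⊔ ℓ)
  Annihilator S v = ∀ r → S r → ⟨ r , v ⟩ ≈ 0#

  -- generators of the space of relations 𝔑 of NC M (Theorem 3.15)
  data RGen (v : Vec3) : Set (c ⊔ ℓ) where
    rel₁ : ∀ p₀ p₁ p₂ q₀ q₁ q₂ r₀ r₁ →
           p₁ ⋆ q₀ ≡ r₁ ⋆ r₀ → ¬ (p₁ ⋆ q₀ ≡ 𝟙) →
           v ≈V ((T p₀ p₁ p₂ ∘⟨ ∘₁ ⟩ T q₀ q₁ q₂) -V (T p₀ r₁ p₂ ∘⟨ ∘₁ ⟩ T r₀ q₁ q₂)) →
           RGen v
    rel₂ : ∀ p₀ p₁ p₂ q₀ q₁ q₂ r₀ r₂ →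
           p₁ ⋆ q₀ ≡ 𝟙 → r₂ ⋆ r₀ ≡ 𝟙 →
           v ≈V ((T p₀ p₁ p₂ ∘⟨ ∘₁ ⟩ T q₀ q₁ q₂) -V (T p₀ q₁ r₂ ∘⟨ ∘₂ ⟩ T r₀ q₂ p₂)) →
           RGen v
    rel₃ : ∀ p₀ p₁ p₂ q₀ q₁ q₂ r₀ r₂ →
           p₂ ⋆ q₀ ≡ r₂ ⋆ r₀ → ¬ (p₂ ⋆ q₀ ≡ 𝟙) →
           v ≈V ((T p₀ p₁ p₂ ∘⟨ ∘₂ ⟩ T q₀ q₁ q₂) -V (T p₀ p₁ r₂ ∘⟨ ∘₂ ⟩ T r₀ q₁ q₂)) →
           RGen v

  𝔑 : Vec3 → Set (c ⊔ ℓ)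
  𝔑 = Span RGen

  -- 𝔑^⊥ : the space of relations of the Koszul dual NC M^!
  𝔑⊥ : Vec3 → Set (c ⊔ ℓ)
  𝔑⊥ = Annihilator 𝔑

  data R!Gen (v : Vec3) : Set (c ⊔ ℓ) where
    gen₁ : ∀ p₀ p₂ q₁ q₂ δ → ¬ (δ ≡ 𝟙) →
           v ≈V sumV (λ p₁ → sumV (λ q₀ →
                  [ p₁ ⋆ q₀ ≡ δ ] ·V (T p₀ p₁ p₂ ∘⟨ ∘₁ ⟩ T q₀ q₁ q₂))) →
           R!Gen v
    gen₂ : ∀ p₀ p₂ q₁ q₂ →
           v ≈V sumV (λ p₁ → sumV (λ q₀ →
                  [ p₁ ⋆ q₀ ≡ 𝟙 ] ·V ((T p₀ p₁ p₂ ∘⟨ ∘₁ ⟩ T q₀ q₁ q₂)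
                                      -V (T p₀ q₁ p₁ ∘⟨ ∘₂ ⟩ T q₀ q₂ p₂)))) →
           R!Gen v
    gen₃ : ∀ p₀ p₁ q₁ q₂ δ → ¬ (δ ≡ 𝟙) →
           v ≈V sumV (λ p₂ → sumV (λ q₀ →
                  [ p₂ ⋆ q₀ ≡ δ ] ·V (T p₀ p₁ p₂ ∘⟨ ∘₂ ⟩ T q₀ q₁ q₂))) →
           R!Gen v

  𝔑! : Vec3 → Set (c ⊔ ℓ)
  𝔑! = Span R!Gen

{-# OPTIONS --safe #-}
module Submission where

-- A tree x ∘ᵢ y of arity 3 evaluates in NC M to a clique on the square 1234: the labels of
-- its base and edges, plus the diagonal (1,3) or (2,4) along which the triangles were glued,
-- solid with label p_i ⋆ q₀ unless that label is 𝟙. Every generator of 𝔑 is the difference of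
-- two trees with the same clique, and conversely every tree is linked by such generators to a
-- chosen representative of its clique. Writing σ b = ±1 for the sign of the form at b, v lies
-- in 𝔑⊥ iff b ↦ σ b * v b is constant on the fibres of the evaluation map. Up to a global sign
-- the generators of 𝔑! are the vectors b ↦ σ b * [b lies in the fibre], so their span consists
-- of the same fibre-constant vectors.

open import Defs
open import Function using (_∘_; case_of_)
open import Function.Bundles using (_⇔_; mk⇔; Equivalence)
open import Level using (_⊔_)
open import Data.Empty using (⊥-elim)
open import Data.Fin using (Fin) renaming (zero to fz; suc to fs)
open import Data.Fin.Properties using (_≟_; suc-injective)
open import Data.List using ([]; _∷_; map)
open import Data.Nat using (zero; suc)
open import Data.Product using (∃; ∃₂; _×_; _,_; proj₁; proj₂)
open import Data.Product.Properties using (≡-dec; ,-injective)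
open import Relation.Binary.Definitions using (DecidableEquality)
open import Relation.Binary.PropositionalEquality using (_≡_; _≢_; refl; cong)
import Relation.Binary.PropositionalEquality as ≡
open import Relation.Nullary using (¬_; Dec; yes; no)
open import Relation.Nullary.Decidable using (_×-dec_; map′)

module NCKoszulDual {c ℓ} (K : CharZeroField c ℓ) (M : FiniteUnitaryMagma) where

  open CharZeroField K renaming (refl to ≈-refl; sym to ≈-sym; trans to ≈-trans)
  open FiniteUnitaryMagma M
  open Koszul K M
  open import Algebra.Properties.Ring ring
    using (-1*x≈-x; -‿involutive; -0#≈0#; x[y-z]≈xy-xz; [y-z]x≈yx-zx; x∙y⁻¹≈ε⇒x≈y)
  open import Algebra.Properties.CommutativeSemigroup +-commutativeSemigroup using (interchange)
  open import Algebra.Properties.CommutativeSemigroup *-commutativeSemigroup using (x∙yz≈y∙xz)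
  open import Algebra.Solver.Ring.NaturalCoefficients.Default commutativeSemiring
    using (solve; _:=_; _:+_; _:*_)
  open import Relation.Binary.Reasoning.Setoid setoid

  χ : ∀ {p} {P : Set p} → Dec P → Carrier
  χ (yes _) = 1#
  χ (no _)  = 0#

  module _ {p q} {P : Set p} {Q : Set q} where

    χ-cong : (P → Q) → (Q → P) → (P? : Dec P) (Q? : Dec Q) → χ P? ≈ χ Q?
    χ-cong _ _ (yes _) (yes _) = ≈-refl
    χ-cong f _ (yes p) (no ¬q) = ⊥-elim (¬q (f p))
    χ-cong _ g (no ¬p) (yes q) = ⊥-elim (¬p (g q))
    χ-cong _ _ (no _)  (no _)  = ≈-refl

    χ-× : (P? : Dec P) (Q? : Dec Q) → χ P? * χ Q? ≈ χ (P? ×-dec Q?)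
    χ-× (yes _) (yes _) = *-identityˡ 1#
    χ-× (yes _) (no _)  = zeroʳ 1#
    χ-× (no _)  Q?      = zeroˡ (χ Q?)

  χ-yes : ∀ {p} {P : Set p} → P → (P? : Dec P) → χ P? ≈ 1#
  χ-yes p P? = χ-cong (λ x → x) (λ _ → p) P? (yes p)

  χ-no : ∀ {p} {P : Set p} → ¬ P → (P? : Dec P) → χ P? ≈ 0#
  χ-no ¬p P? = χ-cong (λ x → x) (λ x → x) P? (no ¬p)

  [≡]≈χ : ∀ a b → [ a ≡ b ] ≈ χ (a ≟ b)
  [≡]≈χ a b with a ≟ b
  ... | yes _ = ≈-refl
  ... | no  _ = ≈-refl

  record Summation (A : Set) : Set (c ⊔ ℓ) where
    field
      ∑            : (A → Carrier) → Carrier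
      ∑-cong       : ∀ {f g} → (∀ x → f x ≈ g x) → ∑ f ≈ ∑ g
      ∑-distrib-+  : ∀ f g → ∑ (λ x → f x + g x) ≈ ∑ f + ∑ g
      *-distribˡ-∑ : ∀ k f → k * ∑ f ≈ ∑ (λ x → k * f x)
      ∑-collapse   : ∀ {f} j → (∀ x → x ≢ j → f x ≈ 0#) → ∑ f ≈ f j

    ∑-zero : ∀ {f} → (∀ x → f x ≈ 0#) → ∑ f ≈ 0#
    ∑-zero {f} f≈0 = begin
      ∑ f                ≈⟨ ∑-cong (λ x → ≈-trans (f≈0 x) (≈-sym (zeroˡ 0#))) ⟩
      ∑ (λ _ → 0# * 0#)  ≈⟨ *-distribˡ-∑ 0# (λ _ → 0#) ⟨
      0# * ∑ (λ _ → 0#)  ≈⟨ zeroˡ _ ⟩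
      0#                 ∎

    ∑-distrib-- : ∀ f g → ∑ (λ x → f x - g x) ≈ ∑ f - ∑ g
    ∑-distrib-- f g = begin
      ∑ (λ x → f x - g x)         ≈⟨ ∑-cong (λ x → +-congˡ (-1*x≈-x (g x))) ⟨
      ∑ (λ x → f x + - 1# * g x)  ≈⟨ ∑-distrib-+ f _ ⟩
      ∑ f + ∑ (λ x → - 1# * g x)  ≈⟨ +-congˡ (*-distribˡ-∑ (- 1#) g) ⟨
      ∑ f + - 1# * ∑ g            ≈⟨ +-congˡ (-1*x≈-x _) ⟩
      ∑ f - ∑ g                   ∎

  open Summation

  ∑-Fin : ∀ n → Summation (Fin n)
  ∑-Fin n = record
    { ∑ = sumFin ; ∑-cong = cong′ ; ∑-distrib-+ = distrib-+ ; *-distribˡ-∑ = distribˡ-* ; ∑-collapse = collapse }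
    where
    cong′ : ∀ {n} {f g : Fin n → Carrier} → (∀ x → f x ≈ g x) → sumFin f ≈ sumFin g
    cong′ {zero}  _   = ≈-refl
    cong′ {suc n} f≈g = +-cong (f≈g fz) (cong′ (f≈g ∘ fs))

    distrib-+ : ∀ {n} (f g : Fin n → Carrier) → sumFin (λ x → f x + g x) ≈ sumFin f + sumFin g
    distrib-+ {zero}  _ _ = ≈-sym (+-identityˡ 0#)
    distrib-+ {suc n} f g = ≈-trans (+-congˡ (distrib-+ (f ∘ fs) (g ∘ fs))) (interchange _ _ _ _)

    distribˡ-* : ∀ {n} k (f : Fin n → Carrier) → k * sumFin f ≈ sumFin (λ x → k * f x)
    distribˡ-* {zero}  k _ = zeroʳ k
    distribˡ-* {suc n} k f = ≈-trans (distribˡ k _ _) (+-congˡ (distribˡ-* k (f ∘ fs)))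

    zero′ : ∀ {n} {f : Fin n → Carrier} → (∀ x → f x ≈ 0#) → sumFin f ≈ 0#
    zero′ {zero}  _   = ≈-refl
    zero′ {suc n} f≈0 = ≈-trans (+-cong (f≈0 fz) (zero′ (f≈0 ∘ fs))) (+-identityˡ 0#)

    collapse : ∀ {n} {f : Fin n → Carrier} j → (∀ x → x ≢ j → f x ≈ 0#) → sumFin f ≈ f j
    collapse {suc n} fz     off = ≈-trans (+-congˡ (zero′ (λ x → off (fs x) λ ()))) (+-identityʳ _)
    collapse {suc n} {f} (fs j) off = begin
      f fz + sumFin (f ∘ fs)  ≈⟨ +-cong (off fz λ ()) (collapse j (λ x x≢j → off (fs x) (x≢j ∘ suc-injective))) ⟩
      0# + f (fs j)           ≈⟨ +-identityˡ _ ⟩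
      f (fs j)                ∎

  ∑-× : ∀ {A B} → Summation A → Summation B → Summation (A × B)
  ∑-× SA SB = record
    { ∑            = λ f → ∑ SA (λ a → ∑ SB (λ b → f (a , b)))
    ; ∑-cong       = λ f≈g → ∑-cong SA (λ a → ∑-cong SB (λ b → f≈g (a , b)))
    ; ∑-distrib-+  = λ f g → ≈-trans (∑-cong SA (λ a → ∑-distrib-+ SB _ _)) (∑-distrib-+ SA _ _)
    ; *-distribˡ-∑ = λ k f → ≈-trans (*-distribˡ-∑ SA k _) (∑-cong SA (λ a → *-distribˡ-∑ SB k _))
    ; ∑-collapse   = λ { (j , k) off →
        ≈-trans (∑-collapse SA j (λ a a≢j → ∑-zero SB (λ b → off (a , b) (a≢j ∘ cong proj₁))))
                (∑-collapse SB k (λ b b≢k → off (j , b) (b≢k ∘ cong proj₂))) }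
    }

  ∑-Elt² : Summation (Elt × Elt)
  ∑-Elt² = ∑-× (∑-Fin size) (∑-Fin size)

  -- Its sum is definitionally the nested sum in the definition of ⟨_,_⟩.
  ∑-Basis : Summation Basis
  ∑-Basis = ∑-× ∑-Tri (∑-× ∑-Tri (∑-Fin 2))
    where ∑-Tri = ∑-× (∑-Fin size) ∑-Elt²

  _≟ᴮ_ : DecidableEquality Basis
  _≟ᴮ_ = ≡-dec _≟ᵀ_ (≡-dec _≟ᵀ_ _≟_)
    where _≟ᵀ_ = ≡-dec _≟_ (≡-dec _≟_ _≟_)

  tree : Basis → Vec3
  tree (x , y , i) = x ∘⟨ i ⟩ y

  σ : Basis → Carrier
  σ (_ , _ , i) = sign i

  σ-cancel : ∀ b x → σ b * (σ b * x) ≈ x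
  σ-cancel b x = ≈-trans (≈-sym (*-assoc _ _ x)) (≈-trans (*-congʳ (σ² b)) (*-identityˡ x))
    where
    σ² : ∀ b → σ b * σ b ≈ 1#
    σ² (_ , _ , fz)   = *-identityˡ 1#
    σ² (_ , _ , fs _) = ≈-trans (-1*x≈-x (- 1#)) (-‿involutive 1#)

  eqTri≈χ : ∀ a b c a′ b′ c′ → eqTri (a , b , c) (a′ , b′ , c′) ≈ χ (a ≟ a′ ×-dec b ≟ b′ ×-dec c ≟ c′)
  eqTri≈χ a b c a′ b′ c′ with a ≟ a′ | b ≟ b′ | c ≟ c′
  ... | yes _ | yes _ | yes _ = ≈-refl
  ... | yes _ | yes _ | no  _ = ≈-refl
  ... | yes _ | no  _ | _     = ≈-refl
  ... | no  _ | _     | _     = ≈-refl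

  eqFin2≈χ : ∀ i j → eqFin2 i j ≈ χ (i ≟ j)
  eqFin2≈χ i j with i ≟ j
  ... | yes _ = ≈-refl
  ... | no  _ = ≈-refl

  tree≈χ : ∀ b b′ → tree b b′ ≈ χ (b ≟ᴮ b′)
  tree≈χ b@((x₀ , x₁ , x₂) , (y₀ , y₁ , y₂) , i) b′@((x₀′ , x₁′ , x₂′) , (y₀′ , y₁′ , y₂′) , i′) = begin
    eqTri (x₀ , x₁ , x₂) (x₀′ , x₁′ , x₂′) * (eqTri (y₀ , y₁ , y₂) (y₀′ , y₁′ , y₂′) * eqFin2 i i′)
      ≈⟨ *-cong (eqTri≈χ x₀ x₁ x₂ x₀′ x₁′ x₂′) (*-cong (eqTri≈χ y₀ y₁ y₂ y₀′ y₁′ y₂′) (eqFin2≈χ i i′)) ⟩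
    χ x? * (χ y? * χ (i ≟ i′))
      ≈⟨ ≈-trans (*-congˡ (χ-× y? (i ≟ i′))) (χ-× x? (y? ×-dec i ≟ i′)) ⟩
    χ (x? ×-dec y? ×-dec i ≟ i′)
      ≈⟨ χ-cong (λ { ((refl , refl , refl) , (refl , refl , refl) , refl) → refl })
                (λ { refl → (refl , refl , refl) , (refl , refl , refl) , refl })
                (x? ×-dec y? ×-dec i ≟ i′) (b ≟ᴮ b′) ⟩
    χ (b ≟ᴮ b′) ∎
    where
    x? = x₀ ≟ x₀′ ×-dec x₁ ≟ x₁′ ×-dec x₂ ≟ x₂′
    y? = y₀ ≟ y₀′ ×-dec y₁ ≟ y₁′ ×-dec y₂ ≟ y₂′

  tree-off : ∀ {b b′} → b ≢ b′ → tree b b′ ≈ 0#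
  tree-off {b} {b′} b≢b′ = ≈-trans (tree≈χ b b′) (χ-no b≢b′ (b ≟ᴮ b′))

  *-tree-off : ∀ {k} t b → t ≢ b → k * tree t b ≈ 0#
  *-tree-off _ _ t≢b = ≈-trans (*-congˡ (tree-off t≢b)) (zeroʳ _)

  ∑-tree-collapse : ∀ {A} (S : Summation A) (f : A → Carrier) (t : A → Basis) {b} j →
                    (∀ x → t x ≡ b → x ≡ j) → ∑ S (λ x → f x * tree (t x) b) ≈ f j * tree (t j) b
  ∑-tree-collapse S f t {b} j only-j = ∑-collapse S j (λ x x≢j → *-tree-off (t x) b (x≢j ∘ only-j x))

  [≡]*tree≈χ : ∀ {x y t b r} {R : Set r} (R? : Dec R) → (x ≡ y × t ≡ b) ⇔ R → [ x ≡ y ] * tree t b ≈ χ R?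
  [≡]*tree≈χ {x} {y} {t} {b} R? equivalent = begin
    [ x ≡ y ] * tree t b       ≈⟨ *-cong ([≡]≈χ x y) (tree≈χ t b) ⟩
    χ (x ≟ y) * χ (t ≟ᴮ b)     ≈⟨ χ-× (x ≟ y) (t ≟ᴮ b) ⟩
    χ (x ≟ y ×-dec t ≟ᴮ b)     ≈⟨ χ-cong (Equivalence.to equivalent) (Equivalence.from equivalent) (x ≟ y ×-dec t ≟ᴮ b) R? ⟩
    χ R?                       ∎

  ⟨tree⟩ : ∀ v b → ⟨ tree b , v ⟩ ≈ σ b * v b
  ⟨tree⟩ v b = begin
    ∑ ∑-Basis (λ b′ → σ b′ * (tree b b′ * v b′))
      ≈⟨ ∑-collapse ∑-Basis {λ b′ → σ b′ * (tree b b′ * v b′)} b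
           (λ b′ b′≢b → ≈-trans (*-congˡ (≈-trans (*-congʳ (tree-off (b′≢b ∘ ≡.sym))) (zeroˡ _))) (zeroʳ _)) ⟩
    σ b * (tree b b * v b)
      ≈⟨ *-congˡ (≈-trans (*-congʳ (≈-trans (tree≈χ b b) (χ-yes refl (b ≟ᴮ b)))) (*-identityˡ _)) ⟩
    σ b * v b ∎

  ⟨⟩-congˡ : ∀ v {u u′} → u ≈V u′ → ⟨ u , v ⟩ ≈ ⟨ u′ , v ⟩
  ⟨⟩-congˡ v {u} {u′} u≈u′ =
    ∑-cong ∑-Basis {λ b → σ b * (u b * v b)} {λ b → σ b * (u′ b * v b)} (λ b → *-congˡ (*-congʳ (u≈u′ b)))

  ⟨⟩-zeroˡ : ∀ v → ⟨ 0V , v ⟩ ≈ 0#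
  ⟨⟩-zeroˡ v = ∑-zero ∑-Basis {λ b → σ b * (0# * v b)} (λ b → ≈-trans (*-congˡ (zeroˡ (v b))) (zeroʳ (σ b)))

  ⟨⟩-linearˡ : ∀ v k u w → ⟨ (k ·V u) +V w , v ⟩ ≈ k * ⟨ u , v ⟩ + ⟨ w , v ⟩
  ⟨⟩-linearˡ v k u w = begin
    ∑ ∑-Basis (λ b → σ b * ((k * u b + w b) * v b))
      ≈⟨ ∑-cong ∑-Basis (λ b → pointwise (σ b) (u b) (w b) (v b)) ⟩
    ∑ ∑-Basis (λ b → k * (σ b * (u b * v b)) + σ b * (w b * v b))
      ≈⟨ ∑-distrib-+ ∑-Basis (λ b → k * (σ b * (u b * v b))) (λ b → σ b * (w b * v b)) ⟩
    ∑ ∑-Basis (λ b → k * (σ b * (u b * v b))) + ⟨ w , v ⟩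
      ≈⟨ +-congʳ (*-distribˡ-∑ ∑-Basis k (λ b → σ b * (u b * v b))) ⟨
    k * ⟨ u , v ⟩ + ⟨ w , v ⟩ ∎
    where
    pointwise : ∀ s x y z → s * ((k * x + y) * z) ≈ k * (s * (x * z)) + s * (y * z)
    pointwise = solve 5 (λ k s x y z → s :* ((k :* x :+ y) :* z) := k :* (s :* (x :* z)) :+ s :* (y :* z)) ≈-refl k

  ⟨⟩-distribˡ-- : ∀ v u w → ⟨ u -V w , v ⟩ ≈ ⟨ u , v ⟩ - ⟨ w , v ⟩
  ⟨⟩-distribˡ-- v u w =
    ≈-trans (∑-cong ∑-Basis pointwise) (∑-distrib-- ∑-Basis (λ b → σ b * (u b * v b)) (λ b → σ b * (w b * v b)))
    where
    pointwise : ∀ b → σ b * ((u b - w b) * v b) ≈ σ b * (u b * v b) - σ b * (w b * v b)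
    pointwise b = ≈-trans (*-congˡ ([y-z]x≈yx-zx (v b) (u b) (w b))) (x[y-z]≈xy-xz (σ b) _ _)

  ⟨tree-tree⟩ : ∀ v b b′ → ⟨ tree b -V tree b′ , v ⟩ ≈ σ b * v b - σ b′ * v b′
  ⟨tree-tree⟩ v b b′ =
    ≈-trans (⟨⟩-distribˡ-- v (tree b) (tree b′)) (+-cong (⟨tree⟩ v b) (-‿cong (⟨tree⟩ v b′)))

  module _ {P : Vec3 → Set (c ⊔ ℓ)} where

    Span-ind : ∀ {q} (Q : Vec3 → Set q) → (∀ {u u′} → u ≈V u′ → Q u → Q u′) → Q 0V →
               (∀ k {w u} → P w → Q u → Q ((k ·V w) +V u)) → ∀ {u} → Span P u → Q u
    Span-ind Q resp base step (ws , u≈) = resp (λ b → ≈-sym (u≈ b)) (go ws)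
      where
      -- The underscore is the function forgetting membership proofs in the definition of Span.
      go : ∀ ws → Q (lincomb (map _ ws))
      go []                  = base
      go ((k , (w , p)) ∷ ws) = step k p (go ws)

    Span-resp : ∀ {u u′} → u ≈V u′ → Span P u → Span P u′
    Span-resp u≈u′ (ws , u≈) = ws , λ b → ≈-trans (≈-sym (u≈u′ b)) (u≈ b)

    Span-scaled : ∀ k {w} → P w → Span P (k ·V w)
    Span-scaled k {w} p = (k , (w , p)) ∷ [] , λ b → ≈-sym (+-identityʳ _)

    Span-generator : ∀ {w} → P w → Span P w
    Span-generator p = Span-resp (λ b → *-identityˡ _) (Span-scaled 1# p)

    Span-+ : ∀ {u w} → Span P u → Span P w → Span P (u +V w)
    Span-+ {w = w} spanU spanW = Span-ind (λ u → Span P (u +V w))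
      (λ u≈u′ → Span-resp (λ b → +-congʳ (u≈u′ b)))
      (Span-resp (λ b → ≈-sym (+-identityˡ (w b))) spanW)
      (λ k {x} p (ws , e) → (k , (x , p)) ∷ ws , λ b → ≈-trans (+-assoc _ _ _) (+-congˡ (e b)))
      spanU

    Span-sumV : ∀ {n} {f : Fin n → Vec3} → (∀ i → Span P (f i)) → Span P (sumV f)
    Span-sumV {zero}  _    = [] , λ _ → ≈-refl
    Span-sumV {suc n} span = Span-+ (span fz) (Span-sumV (span ∘ fs))

    Span-annihilated : ∀ {v} → (∀ {w} → P w → ⟨ w , v ⟩ ≈ 0#) → ∀ {u} → Span P u → ⟨ u , v ⟩ ≈ 0#
    Span-annihilated {v} annihilated = Span-ind (λ u → ⟨ u , v ⟩ ≈ 0#)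
      (λ u≈u′ ⟨u,v⟩≈0 → ≈-trans (≈-sym (⟨⟩-congˡ v u≈u′)) ⟨u,v⟩≈0)
      (⟨⟩-zeroˡ v)
      (λ k {w} {u} p ⟨u,v⟩≈0 → begin
        ⟨ (k ·V w) +V u , v ⟩       ≈⟨ ⟨⟩-linearˡ v k w u ⟩
        k * ⟨ w , v ⟩ + ⟨ u , v ⟩   ≈⟨ +-cong (≈-trans (*-congˡ (annihilated p)) (zeroʳ k)) ⟨u,v⟩≈0 ⟩
        0# + 0#                     ≈⟨ +-identityʳ 0# ⟩
        0#                          ∎)

  sumV-Basis : (Basis → Vec3) → Vec3
  sumV-Basis F = sumV λ x₀ → sumV λ x₁ → sumV λ x₂ → sumV λ y₀ → sumV λ y₁ → sumV λ y₂ → sumV λ i →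
    F ((x₀ , x₁ , x₂) , (y₀ , y₁ , y₂) , i)

  Span-sumV-Basis : ∀ {P} {F : Basis → Vec3} → (∀ b → Span P (F b)) → Span P (sumV-Basis F)
  Span-sumV-Basis span =
    Span-sumV λ x₀ → Span-sumV λ x₁ → Span-sumV λ x₂ → Span-sumV λ y₀ → Span-sumV λ y₁ → Span-sumV λ y₂ →
    Span-sumV λ i → span ((x₀ , x₁ , x₂) , (y₀ , y₁ , y₂) , i)

  -- Cliques and fibres

  Quad : Set
  Quad = Elt × Elt × Elt × Elt

  -- solid ∘₁ δ is the diagonal (1,3) and solid ∘₂ δ the diagonal (2,4), labelled δ ≠ 𝟙.
  data Diagonal : Set where
    none  : Diagonal
    solid : Fin 2 → Elt → Diagonal

  -- The labels of the base and of the edges (1,2), (2,3), (3,4), and the solid diagonal if any.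
  Clique : Set
  Clique = Quad × Diagonal

  _≟ᵈ_ : DecidableEquality Diagonal
  none      ≟ᵈ none      = yes refl
  none      ≟ᵈ solid _ _ = no λ ()
  solid _ _ ≟ᵈ none      = no λ ()
  solid i δ ≟ᵈ solid j ε = map′ (λ { (refl , refl) → refl }) (λ { refl → refl , refl }) (i ≟ j ×-dec δ ≟ ε)

  _≟ᶜ_ : DecidableEquality Clique
  _≟ᶜ_ = ≡-dec (≡-dec _≟_ (≡-dec _≟_ (≡-dec _≟_ _≟_))) _≟ᵈ_

  diagonal : Fin 2 → Elt → Diagonal
  diagonal i δ with δ ≟ 𝟙
  ... | yes _ = none
  ... | no  _ = solid i δ

  clique : Basis → Clique
  clique ((p₀ , p₁ , p₂) , (q₀ , q₁ , q₂) , fz)    = (p₀ , q₁ , q₂ , p₂) , diagonal ∘₁ (p₁ ⋆ q₀)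
  clique ((p₀ , p₁ , p₂) , (q₀ , q₁ , q₂) , fs fz) = (p₀ , p₁ , q₁ , q₂) , diagonal ∘₂ (p₂ ⋆ q₀)

  representative : Clique → Basis
  representative ((p₀ , e₁ , e₂ , e₃) , none)            = (p₀ , 𝟙 , e₃) , (𝟙 , e₁ , e₂) , ∘₁
  representative ((p₀ , e₁ , e₂ , e₃) , solid fz δ)      = (p₀ , δ , e₃) , (𝟙 , e₁ , e₂) , ∘₁
  representative ((p₀ , e₁ , e₂ , e₃) , solid (fs fz) δ) = (p₀ , e₁ , δ) , (𝟙 , e₂ , e₃) , ∘₂

  diagonal-𝟙 : ∀ i {δ} → δ ≡ 𝟙 → diagonal i δ ≡ none
  diagonal-𝟙 _ {δ} δ≡𝟙 with δ ≟ 𝟙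
  ... | yes _   = refl
  ... | no δ≢𝟙 = ⊥-elim (δ≢𝟙 δ≡𝟙)

  diagonal-solid : ∀ i {δ} → δ ≢ 𝟙 → diagonal i δ ≡ solid i δ
  diagonal-solid _ {δ} δ≢𝟙 with δ ≟ 𝟙
  ... | yes δ≡𝟙 = ⊥-elim (δ≢𝟙 δ≡𝟙)
  ... | no _    = refl

  diagonal≡none⇒ : ∀ {i δ} → diagonal i δ ≡ none → δ ≡ 𝟙
  diagonal≡none⇒ {δ = δ} e with δ ≟ 𝟙
  diagonal≡none⇒ _  | yes δ≡𝟙 = δ≡𝟙
  diagonal≡none⇒ () | no  _

  diagonal≡solid⇒ : ∀ {i δ j ε} → diagonal i δ ≡ solid j ε → i ≡ j × δ ≡ ε
  diagonal≡solid⇒ {δ = δ} e with δ ≟ 𝟙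
  diagonal≡solid⇒ ()   | yes _
  diagonal≡solid⇒ refl | no  _ = refl , refl

  clique-representative : ∀ b → clique (representative (clique b)) ≡ clique b
  clique-representative ((_ , p₁ , _) , (q₀ , _ , _) , fz) with p₁ ⋆ q₀ ≟ 𝟙
  ... | yes _   = cong (_ ,_) (diagonal-𝟙 ∘₁ (unitˡ 𝟙))
  ... | no δ≢𝟙 = cong (_ ,_) (≡.trans (cong (diagonal ∘₁) (unitʳ _)) (diagonal-solid ∘₁ δ≢𝟙))
  clique-representative ((_ , _ , p₂) , (q₀ , _ , _) , fs fz) with p₂ ⋆ q₀ ≟ 𝟙
  ... | yes _   = cong (_ ,_) (diagonal-𝟙 ∘₁ (unitˡ 𝟙))
  ... | no δ≢𝟙 = cong (_ ,_) (≡.trans (cong (diagonal ∘₂) (unitʳ _)) (diagonal-solid ∘₂ δ≢𝟙))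

  signed : Vec3 → Basis → Carrier
  signed v b = σ b * v b

  FibreConstant : Vec3 → Set ℓ
  FibreConstant v = ∀ b b′ → clique b ≡ clique b′ → signed v b ≈ signed v b′

  FibreConstant-resp : ∀ {u u′} → u ≈V u′ → FibreConstant u → FibreConstant u′
  FibreConstant-resp u≈u′ constant b b′ e =
    ≈-trans (*-congˡ (≈-sym (u≈u′ b))) (≈-trans (constant b b′ e) (*-congˡ (u≈u′ b′)))

  FibreConstant-0V : FibreConstant 0V
  FibreConstant-0V b b′ _ = ≈-trans (zeroʳ (σ b)) (≈-sym (zeroʳ (σ b′)))

  FibreConstant-linear : ∀ k {w u} → FibreConstant w → FibreConstant u → FibreConstant ((k ·V w) +V u)
  FibreConstant-linear k {w} {u} constantW constantU b b′ e = begin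
    σ b * (k * w b + u b)          ≈⟨ expand b ⟩
    k * signed w b + signed u b    ≈⟨ +-cong (*-congˡ (constantW b b′ e)) (constantU b b′ e) ⟩
    k * signed w b′ + signed u b′  ≈⟨ expand b′ ⟨
    σ b′ * (k * w b′ + u b′)       ∎
    where
    expand : ∀ b → σ b * (k * w b + u b) ≈ k * signed w b + signed u b
    expand b = ≈-trans (distribˡ (σ b) _ _) (+-congʳ (x∙yz≈y∙xz (σ b) k (w b)))

  -- The annihilator 𝔑⊥

  module _ {v} (v⊥ : 𝔑⊥ v) where

    relation⇒signed≈ : ∀ b b′ → RGen (tree b -V tree b′) → signed v b ≈ signed v b′
    relation⇒signed≈ b b′ ρ = x∙y⁻¹≈ε⇒x≈y _ _ (begin
      signed v b - signed v b′   ≈⟨ ⟨tree-tree⟩ v b b′ ⟨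
      ⟨ tree b -V tree b′ , v ⟩  ≈⟨ v⊥ _ (Span-generator ρ) ⟩
      0#                         ∎)

    signed≈representative : ∀ b → signed v b ≈ signed v (representative (clique b))
    signed≈representative ((x₀ , x₁ , x₂) , (y₀ , y₁ , y₂) , fz) with x₁ ⋆ y₀ ≟ 𝟙
    ... | no δ≢𝟙 = relation⇒signed≈ ((x₀ , x₁ , x₂) , (y₀ , y₁ , y₂) , ∘₁) ((x₀ , x₁ ⋆ y₀ , x₂) , (𝟙 , y₁ , y₂) , ∘₁)
      (rel₁ x₀ x₁ x₂ y₀ y₁ y₂ 𝟙 (x₁ ⋆ y₀) (≡.sym (unitʳ _)) δ≢𝟙 (λ _ → ≈-refl))
    -- Relations of type (1) need a solid diagonal, so go through a ∘₂-tree of the same clique.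
    ... | yes δ≡𝟙 = ≈-trans
      (relation⇒signed≈ ((x₀ , x₁ , x₂) , (y₀ , y₁ , y₂) , ∘₁) middle
        (rel₂ x₀ x₁ x₂ y₀ y₁ y₂ 𝟙 𝟙 δ≡𝟙 (unitˡ 𝟙) (λ _ → ≈-refl)))
      (≈-sym (relation⇒signed≈ ((x₀ , 𝟙 , x₂) , (𝟙 , y₁ , y₂) , ∘₁) middle
        (rel₂ x₀ 𝟙 x₂ 𝟙 y₁ y₂ 𝟙 𝟙 (unitˡ 𝟙) (unitˡ 𝟙) (λ _ → ≈-refl))))
      where middle = (x₀ , y₁ , 𝟙) , (𝟙 , y₂ , x₂) , ∘₂
    signed≈representative ((x₀ , x₁ , x₂) , (y₀ , y₁ , y₂) , fs fz) with x₂ ⋆ y₀ ≟ 𝟙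
    ... | no δ≢𝟙 = relation⇒signed≈ ((x₀ , x₁ , x₂) , (y₀ , y₁ , y₂) , ∘₂) ((x₀ , x₁ , x₂ ⋆ y₀) , (𝟙 , y₁ , y₂) , ∘₂)
      (rel₃ x₀ x₁ x₂ y₀ y₁ y₂ 𝟙 (x₂ ⋆ y₀) (≡.sym (unitʳ _)) δ≢𝟙 (λ _ → ≈-refl))
    ... | yes δ≡𝟙 = ≈-sym (relation⇒signed≈ ((x₀ , 𝟙 , y₂) , (𝟙 , x₁ , y₁) , ∘₁) ((x₀ , x₁ , x₂) , (y₀ , y₁ , y₂) , ∘₂)
      (rel₂ x₀ 𝟙 y₂ 𝟙 x₁ y₁ y₀ x₂ (unitˡ 𝟙) δ≡𝟙 (λ _ → ≈-refl)))

  𝔑⊥⇒FibreConstant : ∀ {v} → 𝔑⊥ v → FibreConstant v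
  𝔑⊥⇒FibreConstant {v} v⊥ b b′ e = begin
    signed v b                             ≈⟨ signed≈representative {v} v⊥ b ⟩
    signed v (representative (clique b))   ≡⟨ cong (signed v ∘ representative) e ⟩
    signed v (representative (clique b′))  ≈⟨ signed≈representative {v} v⊥ b′ ⟨
    signed v b′                            ∎

  RGen⇒sameCliqueDifference : ∀ {ρ} → RGen ρ → ∃₂ λ b b′ → clique b ≡ clique b′ × ρ ≈V (tree b -V tree b′)
  RGen⇒sameCliqueDifference (rel₁ p₀ p₁ p₂ q₀ q₁ q₂ r₀ r₁ e _ ρ≈) =
    ((p₀ , p₁ , p₂) , (q₀ , q₁ , q₂) , ∘₁) , ((p₀ , r₁ , p₂) , (r₀ , q₁ , q₂) , ∘₁) ,
    cong (λ δ → _ , diagonal ∘₁ δ) e , ρ≈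
  RGen⇒sameCliqueDifference (rel₂ p₀ p₁ p₂ q₀ q₁ q₂ r₀ r₂ e₁ e₂ ρ≈) =
    ((p₀ , p₁ , p₂) , (q₀ , q₁ , q₂) , ∘₁) , ((p₀ , q₁ , r₂) , (r₀ , q₂ , p₂) , ∘₂) ,
    cong (_ ,_) (≡.trans (diagonal-𝟙 ∘₁ e₁) (≡.sym (diagonal-𝟙 ∘₂ e₂))) , ρ≈
  RGen⇒sameCliqueDifference (rel₃ p₀ p₁ p₂ q₀ q₁ q₂ r₀ r₂ e _ ρ≈) =
    ((p₀ , p₁ , p₂) , (q₀ , q₁ , q₂) , ∘₂) , ((p₀ , p₁ , r₂) , (r₀ , q₁ , q₂) , ∘₂) ,
    cong (λ δ → _ , diagonal ∘₂ δ) e , ρ≈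

  FibreConstant⇒𝔑⊥ : ∀ {v} → FibreConstant v → 𝔑⊥ v
  FibreConstant⇒𝔑⊥ {v} constant _ = Span-annihilated {v = v} relation-annihilated
    where
    relation-annihilated : ∀ {ρ} → RGen ρ → ⟨ ρ , v ⟩ ≈ 0#
    relation-annihilated {ρ} r with RGen⇒sameCliqueDifference r
    ... | b , b′ , e , ρ≈ = begin
      ⟨ ρ , v ⟩                  ≈⟨ ⟨⟩-congˡ v ρ≈ ⟩
      ⟨ tree b -V tree b′ , v ⟩  ≈⟨ ⟨tree-tree⟩ v b b′ ⟩
      signed v b - signed v b′   ≈⟨ +-congʳ (constant b b′ e) ⟩
      signed v b′ - signed v b′  ≈⟨ -‿inverseʳ _ ⟩
      0#                         ∎

  -- The span 𝔑!

  -- The sign σ (representative k) makes classVector k coincide with the generator of 𝔑! for k.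
  classVector : Clique → Vec3
  classVector k b = σ (representative k) * (σ b * χ (clique b ≟ᶜ k))

  classVector-FibreConstant : ∀ k → FibreConstant (classVector k)
  classVector-FibreConstant k b b′ e = begin
    signed (classVector k) b                   ≈⟨ signed-classVector b ⟩
    σ (representative k) * χ (clique b ≟ᶜ k)   ≡⟨ cong (λ k′ → σ (representative k) * χ (k′ ≟ᶜ k)) e ⟩
    σ (representative k) * χ (clique b′ ≟ᶜ k)  ≈⟨ signed-classVector b′ ⟨
    signed (classVector k) b′                  ∎
    where
    signed-classVector : ∀ b → signed (classVector k) b ≈ σ (representative k) * χ (clique b ≟ᶜ k)
    signed-classVector b = ≈-trans (x∙yz≈y∙xz (σ b) _ _) (*-congˡ (σ-cancel b _))

  σ-solid : ∀ {q i δ} b → clique b ≡ (q , solid i δ) → σ b ≡ σ (representative (q , solid i δ))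
  σ-solid (_ , _ , fz)    e with diagonal≡solid⇒ (cong proj₂ e)
  ... | refl , _ = refl
  σ-solid (_ , _ , fs fz) e with diagonal≡solid⇒ (cong proj₂ e)
  ... | refl , _ = refl

  classVector-solid : ∀ {q i δ} b → classVector (q , solid i δ) b ≈ χ (clique b ≟ᶜ (q , solid i δ))
  classVector-solid {q} {i} {δ} b with clique b ≟ᶜ (q , solid i δ)
  ... | yes e rewrite σ-solid b e = σ-cancel (representative (q , solid i δ)) 1#
  ... | no  _ = ≈-trans (*-congˡ (zeroʳ (σ b))) (zeroʳ _)

  classVector-none : ∀ {q} b → classVector (q , none) b ≈ σ b * χ (clique b ≟ᶜ (q , none))
  classVector-none b = *-identityˡ _

  R!₁ : Elt → Elt → Elt → Elt → Elt → Vec3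
  R!₁ p₀ p₂ q₁ q₂ δ = sumV λ p₁ → sumV λ q₀ → [ p₁ ⋆ q₀ ≡ δ ] ·V (T p₀ p₁ p₂ ∘⟨ ∘₁ ⟩ T q₀ q₁ q₂)

  R!₁≈classVector : ∀ {p₀ p₂ q₁ q₂ δ} → δ ≢ 𝟙 →
                    R!₁ p₀ p₂ q₁ q₂ δ ≈V classVector ((p₀ , q₁ , q₂ , p₂) , solid ∘₁ δ)
  R!₁≈classVector {p₀} {p₂} {q₁} {q₂} {δ} δ≢𝟙 b@((x₀ , x₁ , x₂) , (y₀ , y₁ , y₂) , i) = begin
    R!₁ p₀ p₂ q₁ q₂ δ b
      ≈⟨ ∑-tree-collapse ∑-Elt² (λ (p₁ , q₀) → [ p₁ ⋆ q₀ ≡ δ ])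
           (λ (p₁ , q₀) → (p₀ , p₁ , p₂) , (q₀ , q₁ , q₂) , ∘₁) {b} (x₁ , y₀) (λ { _ refl → refl }) ⟩
    [ x₁ ⋆ y₀ ≡ δ ] * tree ((p₀ , x₁ , p₂) , (y₀ , q₁ , q₂) , ∘₁) b
      ≈⟨ [≡]*tree≈χ (clique b ≟ᶜ k) (fibre i) ⟩
    χ (clique b ≟ᶜ k)
      ≈⟨ classVector-solid b ⟨
    classVector k b ∎
    where
    k = (p₀ , q₁ , q₂ , p₂) , solid ∘₁ δ
    fibre : ∀ i → (x₁ ⋆ y₀ ≡ δ × ((p₀ , x₁ , p₂) , (y₀ , q₁ , q₂) , ∘₁) ≡ ((x₀ , x₁ , x₂) , (y₀ , y₁ , y₂) , i))
                  ⇔ (clique ((x₀ , x₁ , x₂) , (y₀ , y₁ , y₂) , i) ≡ k)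
    fibre fz      = mk⇔ (λ { (refl , refl) → cong (_ ,_) (diagonal-solid ∘₁ δ≢𝟙) })
                        (λ e → case ,-injective e of λ { (refl , d) → proj₂ (diagonal≡solid⇒ d) , refl })
    fibre (fs fz) = mk⇔ (λ { (_ , ()) }) (λ e → case diagonal≡solid⇒ (proj₂ (,-injective e)) of λ { (() , _) })

  R!₂ : Elt → Elt → Elt → Elt → Vec3
  R!₂ p₀ p₂ q₁ q₂ = sumV λ p₁ → sumV λ q₀ →
    [ p₁ ⋆ q₀ ≡ 𝟙 ] ·V ((T p₀ p₁ p₂ ∘⟨ ∘₁ ⟩ T q₀ q₁ q₂) -V (T p₀ q₁ p₁ ∘⟨ ∘₂ ⟩ T q₀ q₂ p₂))

  R!₂-at : ∀ {p₀ p₂ q₁ q₂} x₀ x₁ x₂ y₀ y₁ y₂ i → let b = (x₀ , x₁ , x₂) , (y₀ , y₁ , y₂) , i in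
           R!₂ p₀ p₂ q₁ q₂ b ≈ [ x₁ ⋆ y₀ ≡ 𝟙 ] * tree ((p₀ , x₁ , p₂) , (y₀ , q₁ , q₂) , ∘₁) b
                             - [ x₂ ⋆ y₀ ≡ 𝟙 ] * tree ((p₀ , q₁ , x₂) , (y₀ , q₂ , p₂) , ∘₂) b
  R!₂-at {p₀} {p₂} {q₁} {q₂} x₀ x₁ x₂ y₀ y₁ y₂ i = begin
    ∑ ∑-Elt² (λ (p₁ , q₀) → unit? (p₁ , q₀) * (tree (t₁ (p₁ , q₀)) b - tree (t₂ (p₁ , q₀)) b))
      ≈⟨ ∑-cong ∑-Elt² (λ _ → x[y-z]≈xy-xz _ _ _) ⟩
    ∑ ∑-Elt² (λ x → term t₁ x - term t₂ x)
      ≈⟨ ∑-distrib-- ∑-Elt² (term t₁) (term t₂) ⟩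
    ∑ ∑-Elt² (term t₁) - ∑ ∑-Elt² (term t₂)
      ≈⟨ +-cong (∑-tree-collapse ∑-Elt² unit? t₁ {b} (x₁ , y₀) (λ { _ refl → refl }))
                (-‿cong (∑-tree-collapse ∑-Elt² unit? t₂ {b} (x₂ , y₀) (λ { _ refl → refl }))) ⟩
    unit? (x₁ , y₀) * tree (t₁ (x₁ , y₀)) b - unit? (x₂ , y₀) * tree (t₂ (x₂ , y₀)) b ∎
    where
    b = (x₀ , x₁ , x₂) , (y₀ , y₁ , y₂) , i
    unit? : Elt × Elt → Carrier
    unit? (p₁ , q₀) = [ p₁ ⋆ q₀ ≡ 𝟙 ]
    t₁ t₂ : Elt × Elt → Basis
    t₁ (p₁ , q₀) = (p₀ , p₁ , p₂) , (q₀ , q₁ , q₂) , ∘₁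
    t₂ (p₁ , q₀) = (p₀ , q₁ , p₁) , (q₀ , q₂ , p₂) , ∘₂
    term : (Elt × Elt → Basis) → Elt × Elt → Carrier
    term t x = unit? x * tree (t x) b

  R!₂≈classVector : ∀ {p₀ p₂ q₁ q₂} → R!₂ p₀ p₂ q₁ q₂ ≈V classVector ((p₀ , q₁ , q₂ , p₂) , none)
  R!₂≈classVector {p₀} {p₂} {q₁} {q₂} b@((x₀ , x₁ , x₂) , (y₀ , y₁ , y₂) , fz) = begin
    R!₂ p₀ p₂ q₁ q₂ b
      ≈⟨ R!₂-at {p₀} {p₂} {q₁} {q₂} x₀ x₁ x₂ y₀ y₁ y₂ ∘₁ ⟩
    [ x₁ ⋆ y₀ ≡ 𝟙 ] * tree t₁ b - [ x₂ ⋆ y₀ ≡ 𝟙 ] * tree t₂ b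
      ≈⟨ +-cong ([≡]*tree≈χ {t = t₁} {b} (clique b ≟ᶜ k) fibre) (-‿cong (*-tree-off t₂ b λ ())) ⟩
    χ (clique b ≟ᶜ k) - 0#       ≈⟨ ≈-trans (+-congˡ -0#≈0#) (+-identityʳ _) ⟩
    χ (clique b ≟ᶜ k)            ≈⟨ ≈-trans (classVector-none b) (*-identityˡ _) ⟨
    classVector k b              ∎
    where
    k = (p₀ , q₁ , q₂ , p₂) , none
    t₁ t₂ : Basis
    t₁ = (p₀ , x₁ , p₂) , (y₀ , q₁ , q₂) , ∘₁
    t₂ = (p₀ , q₁ , x₂) , (y₀ , q₂ , p₂) , ∘₂
    fibre = mk⇔ (λ { (e , refl) → cong (_ ,_) (diagonal-𝟙 ∘₁ e) })
                (λ e → case ,-injective e of λ { (refl , d) → diagonal≡none⇒ d , refl })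
  R!₂≈classVector {p₀} {p₂} {q₁} {q₂} b@((x₀ , x₁ , x₂) , (y₀ , y₁ , y₂) , fs fz) = begin
    R!₂ p₀ p₂ q₁ q₂ b
      ≈⟨ R!₂-at {p₀} {p₂} {q₁} {q₂} x₀ x₁ x₂ y₀ y₁ y₂ ∘₂ ⟩
    [ x₁ ⋆ y₀ ≡ 𝟙 ] * tree t₁ b - [ x₂ ⋆ y₀ ≡ 𝟙 ] * tree t₂ b
      ≈⟨ +-cong (*-tree-off t₁ b λ ()) (-‿cong ([≡]*tree≈χ {t = t₂} {b} (clique b ≟ᶜ k) fibre)) ⟩
    0# - χ (clique b ≟ᶜ k)       ≈⟨ +-identityˡ _ ⟩
    - χ (clique b ≟ᶜ k)          ≈⟨ ≈-trans (classVector-none b) (-1*x≈-x _) ⟨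
    classVector k b              ∎
    where
    k = (p₀ , q₁ , q₂ , p₂) , none
    t₁ t₂ : Basis
    t₁ = (p₀ , x₁ , p₂) , (y₀ , q₁ , q₂) , ∘₁
    t₂ = (p₀ , q₁ , x₂) , (y₀ , q₂ , p₂) , ∘₂
    fibre = mk⇔ (λ { (e , refl) → cong (_ ,_) (diagonal-𝟙 ∘₂ e) })
                (λ e → case ,-injective e of λ { (refl , d) → diagonal≡none⇒ d , refl })

  R!₃ : Elt → Elt → Elt → Elt → Elt → Vec3
  R!₃ p₀ p₁ q₁ q₂ δ = sumV λ p₂ → sumV λ q₀ → [ p₂ ⋆ q₀ ≡ δ ] ·V (T p₀ p₁ p₂ ∘⟨ ∘₂ ⟩ T q₀ q₁ q₂)

  R!₃≈classVector : ∀ {p₀ p₁ q₁ q₂ δ} → δ ≢ 𝟙 →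
                    R!₃ p₀ p₁ q₁ q₂ δ ≈V classVector ((p₀ , p₁ , q₁ , q₂) , solid ∘₂ δ)
  R!₃≈classVector {p₀} {p₁} {q₁} {q₂} {δ} δ≢𝟙 b@((x₀ , x₁ , x₂) , (y₀ , y₁ , y₂) , i) = begin
    R!₃ p₀ p₁ q₁ q₂ δ b
      ≈⟨ ∑-tree-collapse ∑-Elt² (λ (p₂ , q₀) → [ p₂ ⋆ q₀ ≡ δ ])
           (λ (p₂ , q₀) → (p₀ , p₁ , p₂) , (q₀ , q₁ , q₂) , ∘₂) {b} (x₂ , y₀) (λ { _ refl → refl }) ⟩
    [ x₂ ⋆ y₀ ≡ δ ] * tree ((p₀ , p₁ , x₂) , (y₀ , q₁ , q₂) , ∘₂) b
      ≈⟨ [≡]*tree≈χ (clique b ≟ᶜ k) (fibre i) ⟩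
    χ (clique b ≟ᶜ k)
      ≈⟨ classVector-solid b ⟨
    classVector k b ∎
    where
    k = (p₀ , p₁ , q₁ , q₂) , solid ∘₂ δ
    fibre : ∀ i → (x₂ ⋆ y₀ ≡ δ × ((p₀ , p₁ , x₂) , (y₀ , q₁ , q₂) , ∘₂) ≡ ((x₀ , x₁ , x₂) , (y₀ , y₁ , y₂) , i))
                  ⇔ (clique ((x₀ , x₁ , x₂) , (y₀ , y₁ , y₂) , i) ≡ k)
    fibre fz      = mk⇔ (λ { (_ , ()) }) (λ e → case diagonal≡solid⇒ (proj₂ (,-injective e)) of λ { (() , _) })
    fibre (fs fz) = mk⇔ (λ { (refl , refl) → cong (_ ,_) (diagonal-solid ∘₂ δ≢𝟙) })
                        (λ e → case ,-injective e of λ { (refl , d) → proj₂ (diagonal≡solid⇒ d) , refl })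

  R!Gen⇒classVector : ∀ {w} → R!Gen w → ∃ λ k → w ≈V classVector k
  R!Gen⇒classVector (gen₁ p₀ p₂ q₁ q₂ δ δ≢𝟙 w≈) =
    _ , λ b → ≈-trans (w≈ b) (R!₁≈classVector {p₀} {p₂} {q₁} {q₂} δ≢𝟙 b)
  R!Gen⇒classVector (gen₂ p₀ p₂ q₁ q₂ w≈) =
    _ , λ b → ≈-trans (w≈ b) (R!₂≈classVector {p₀} {p₂} {q₁} {q₂} b)
  R!Gen⇒classVector (gen₃ p₀ p₁ q₁ q₂ δ δ≢𝟙 w≈) =
    _ , λ b → ≈-trans (w≈ b) (R!₃≈classVector {p₀} {p₁} {q₁} {q₂} δ≢𝟙 b)

  classVector-R!Gen : ∀ b → R!Gen (classVector (clique b))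
  classVector-R!Gen ((x₀ , x₁ , x₂) , (y₀ , y₁ , y₂) , fz) with x₁ ⋆ y₀ ≟ 𝟙
  ... | yes _   = gen₂ x₀ x₂ y₁ y₂ (λ b → ≈-sym (R!₂≈classVector {x₀} {x₂} {y₁} {y₂} b))
  ... | no δ≢𝟙 = gen₁ x₀ x₂ y₁ y₂ (x₁ ⋆ y₀) δ≢𝟙 (λ b → ≈-sym (R!₁≈classVector {x₀} {x₂} {y₁} {y₂} δ≢𝟙 b))
  classVector-R!Gen ((x₀ , x₁ , x₂) , (y₀ , y₁ , y₂) , fs fz) with x₂ ⋆ y₀ ≟ 𝟙
  ... | yes _   = gen₂ x₀ y₂ x₁ y₁ (λ b → ≈-sym (R!₂≈classVector {x₀} {y₂} {x₁} {y₁} b))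
  ... | no δ≢𝟙 = gen₃ x₀ x₁ y₁ y₂ (x₂ ⋆ y₀) δ≢𝟙 (λ b → ≈-sym (R!₃≈classVector {x₀} {x₁} {y₁} {y₂} δ≢𝟙 b))

  𝔑!⇒FibreConstant : ∀ {v} → 𝔑! v → FibreConstant v
  𝔑!⇒FibreConstant = Span-ind FibreConstant FibreConstant-resp FibreConstant-0V
    (λ k w∈R! → FibreConstant-linear k (generator-FibreConstant w∈R!))
    where
    generator-FibreConstant : ∀ {w} → R!Gen w → FibreConstant w
    generator-FibreConstant w∈R! with R!Gen⇒classVector w∈R!
    ... | k , w≈ = FibreConstant-resp (λ b → ≈-sym (w≈ b)) (classVector-FibreConstant k)

  expansion : ∀ {v} → FibreConstant v →
              v ≈V sumV-Basis (λ b → (χ (b ≟ᴮ representative (clique b)) * v b) ·V classVector (clique b))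
  expansion {v} constant b′ = ≈-sym (begin
    ∑ ∑-Basis (λ b → coefficient b * classVector (clique b) b′)
      ≈⟨ ∑-collapse ∑-Basis {λ b → coefficient b * classVector (clique b) b′} r off-r ⟩
    coefficient r * classVector (clique r) b′
      ≡⟨ cong (λ k → (χ (r ≟ᴮ representative k) * v r) * classVector k b′) (clique-representative b′) ⟩
    (χ (r ≟ᴮ r) * v r) * classVector (clique b′) b′
      ≈⟨ *-cong (≈-trans (*-congʳ (χ-yes refl (r ≟ᴮ r))) (*-identityˡ _))
                (*-congˡ (≈-trans (*-congˡ (χ-yes refl (clique b′ ≟ᶜ clique b′))) (*-identityʳ _))) ⟩
    v r * (σ r * σ b′)
      ≈⟨ solve 3 (λ x s t → x :* (s :* t) := t :* (s :* x)) ≈-refl (v r) (σ r) (σ b′) ⟩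
    σ b′ * signed v r
      ≈⟨ *-congˡ (constant r b′ (clique-representative b′)) ⟩
    σ b′ * (σ b′ * v b′)
      ≈⟨ σ-cancel b′ (v b′) ⟩
    v b′ ∎)
    where
    r = representative (clique b′)
    coefficient : Basis → Carrier
    coefficient b = χ (b ≟ᴮ representative (clique b)) * v b
    off-r : ∀ b → b ≢ r → coefficient b * classVector (clique b) b′ ≈ 0#
    off-r b b≢r with b ≟ᴮ representative (clique b)
    ... | no _      = ≈-trans (*-congʳ (zeroˡ (v b))) (zeroˡ _)
    ... | yes b≡rep = ≈-trans (*-congˡ vanishes) (zeroʳ _)
      where
      other-clique : clique b′ ≢ clique b
      other-clique e = b≢r (≡.trans b≡rep (cong representative (≡.sym e)))
      vanishes : classVector (clique b) b′ ≈ 0#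
      vanishes = ≈-trans (*-congˡ (≈-trans (*-congˡ (χ-no other-clique (clique b′ ≟ᶜ clique b))) (zeroʳ _))) (zeroʳ _)

  FibreConstant⇒𝔑! : ∀ {v} → FibreConstant v → 𝔑! v
  FibreConstant⇒𝔑! {v} constant = Span-resp (λ b → ≈-sym (expansion constant b))
    (Span-sumV-Basis (λ b → Span-scaled (χ (b ≟ᴮ representative (clique b)) * v b) (classVector-R!Gen b)))

proposition4p1 : ∀ {c ℓ} (K : CharZeroField c ℓ) (M : FiniteUnitaryMagma) →
    let open Koszul K M in
    ∀ (v : Vec3) → 𝔑⊥ v ⇔ 𝔑! v
proposition4p1 K M v = mk⇔ (FibreConstant⇒𝔑! ∘ 𝔑⊥⇒FibreConstant) (FibreConstant⇒𝔑⊥ ∘ 𝔑!⇒FibreConstant)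
  where open NCKoszulDual K M
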